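{- Assume that every rule for $f$ has one of the following forms: (S$_\beta$) $\dfrac{x_1\xrightarrow{\beta}y_1\ \ x_2\xrightarrow{\bar\beta}y_2}{f(x_1,x_2)\xrightarrow{\tau}y_1\parallel y_2}$ with $\beta\in\{a,\bar a\}$; (L$_\mu$) $\dfrac{x_1\xrightarrow{\mu}y_1}{f(x_1,x_2)\xrightarrow{\mu}y_1\parallel x_2}$; (R$_\mu$) $\dfrac{x_2\xrightarrow{\mu}y_2}{f(x_1,x_2)\xrightarrow{\mu}x_1\parallel y_2}$. If $f$ has a rule of form S$_\beta$ for at least one $\beta\in\{a,\bar a\}$, and for each $\mu\in\mathcal A$ it has at least one of the rules L$_\mu$, R$_\mu$, then the equation $x\parallel y\approx f(x,y)+f(y,x)$ is sound modulo bisimilarity.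
   Context: Actions: $\mathcal A=\{a,\bar a,\tau\}$ with $a\ne\bar a$, $\bar{\bar a}=a$. CCS$_f$ terms: $t::=\mathbf 0\mid x\mid \mu.t\mid t+t\mid t\parallel t\mid f(t,t)$. The semantics is the labelled transition system on closed terms generated by the following rules, plus the rules for $f$: - $\mu.x\xrightarrow{\mu}x$; - from $x\xrightarrow{\mu}x'$ infer $x+y\xrightarrow{\mu}x'$, $y+x\xrightarrow{\mu}x'$, $x\parallel y\xrightarrow{\mu}x'\parallel y$ and $y\parallel x\xrightarrow{\mu}y\parallel x'$; - from $x\xrightarrow{\beta}x'$ and $y\xrightarrow{\bar\beta}y'$ ($\beta\in\{a,\bar a\}$) infer $x\parallel y\xrightarrow{\tau}x'\parallel y'$. $\underline{\leftrightarrow}$ is strong bisimilarity on closed terms. An equation $t\approx u$ is sound if $\sigma(t)\,\underline{\leftrightarrow}\,\sigma(u)$ for all closed substitutions $\sigma$. -}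

module Defs where

open import Data.Bool using (Bool; true; false)
open import Data.Empty using (⊥)
open import Data.Fin using (Fin; zero; suc)
open import Data.Product using (Σ; _×_; _,_; ∃)
open import Data.Sum using (_⊎_)
open import Relation.Binary.Core using (Rel)
open import Relation.Binary.PropositionalEquality using (_≡_)
open import Level using (0ℓ)

data Name : Set where
  a  : Name
  a̅ : Name

co : Name → Name
co a  = a̅
co a̅ = a

data Act : Set where
  vis : Name → Act
  τ   : Act

infixr 6 _+ₜ_
infixr 5 _∥_
data Term (V : Set) : Set where
  𝟎    : Term V
  var  : V → Term V
  _∙_  : Act → Term V → Term V
  _+ₜ_ : Term V → Term V → Term V
  _∥_  : Term V → Term V → Term V
  f    : Term V → Term V → Term V

CTerm : Set
CTerm = Term ⊥

subst : {V W : Set} → (V → Term W) → Term V → Term W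
subst σ 𝟎 = 𝟎
subst σ (var x) = σ x
subst σ (μ ∙ t) = μ ∙ subst σ t
subst σ (t +ₜ u) = subst σ t +ₜ subst σ u
subst σ (t ∥ u) = subst σ t ∥ subst σ u
subst σ (f t u) = f (subst σ t) (subst σ u)

-- A set of rules for f, each of form S_β, L_μ or R_μ:
-- hasS β = true iff rule S_β is present, etc.
record FRules : Set where
  field
    hasS : Name → Bool
    hasL : Act → Bool
    hasR : Act → Bool
open FRules public

data Step (ρ : FRules) : CTerm → Act → CTerm → Set where
  pre   : ∀ {μ p} → Step ρ (μ ∙ p) μ p
  sumL  : ∀ {p q μ p'} → Step ρ p μ p' → Step ρ (p +ₜ q) μ p'
  sumR  : ∀ {p q μ q'} → Step ρ q μ q' → Step ρ (p +ₜ q) μ q'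
  parL  : ∀ {p q μ p'} → Step ρ p μ p' → Step ρ (p ∥ q) μ (p' ∥ q)
  parR  : ∀ {p q μ q'} → Step ρ q μ q' → Step ρ (p ∥ q) μ (p ∥ q')
  sync  : ∀ {p q p' q' β} → Step ρ p (vis β) p' → Step ρ q (vis (co β)) q' →
          Step ρ (p ∥ q) τ (p' ∥ q')
  fS    : ∀ {p q p' q' β} → hasS ρ β ≡ true →
          Step ρ p (vis β) p' → Step ρ q (vis (co β)) q' →
          Step ρ (f p q) τ (p' ∥ q')
  fL    : ∀ {p q p' μ} → hasL ρ μ ≡ true → Step ρ p μ p' →
          Step ρ (f p q) μ (p' ∥ q)
  fR    : ∀ {p q q' μ} → hasR ρ μ ≡ true → Step ρ q μ q' →
          Step ρ (f p q) μ (p ∥ q')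

IsBisimulation : FRules → Rel CTerm 0ℓ → Set
IsBisimulation ρ R =
  ∀ {p q} → R p q →
    (∀ {μ p'} → Step ρ p μ p' → Σ CTerm λ q' → Step ρ q μ q' × R p' q')
  × (∀ {μ q'} → Step ρ q μ q' → Σ CTerm λ p' → Step ρ p μ p' × R p' q')

Bisimilar : FRules → CTerm → CTerm → Set₁
Bisimilar ρ p q = Σ (Rel CTerm 0ℓ) λ R → IsBisimulation ρ R × R p q

Sound : {V : Set} → FRules → Term V → Term V → Set₁
Sound {V} ρ t u = (σ : V → CTerm) → Bisimilar ρ (subst σ t) (subst σ u)

x y : Term (Fin 2)
x = var zero
y = var (suc zero)

module Submission where

open import Defs
open import Data.Bool using (true)
open import Data.Product using (∃; Σ; _×_; _,_)
open import Data.Sum using (_⊎_; inj₁; inj₂)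
open import Relation.Binary.PropositionalEquality using (_≡_; refl)

-- The relation containing the identity, all pairs (p ∥ q , q ∥ p)
-- and all pairs (p ∥ q , f(p,q) + f(q,p)) is a bisimulation.  An interleaving step
-- of p ∥ q is matched by whichever of L_μ, R_μ is present, taken in the summand
-- f(p,q) or f(q,p) that puts the residual back in the right order (up to the swap);
-- a synchronisation on β is matched by S_β in f(p,q) or by S_β̄ in f(q,p).
-- Conversely every rule of f yields a residual of the form p' ∥ q or q ∥ p'.

step-co² : ∀ {ρ p β p'} → Step ρ p (vis β) p' → Step ρ p (vis (co (co β))) p'
step-co² {β = a}  s = s
step-co² {β = a̅} s = s

sync-comm : ∀ {ρ p q p' q' β} → Step ρ p (vis β) p' → Step ρ q (vis (co β)) q' →
            Step ρ (q ∥ p) τ (q' ∥ p')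
sync-comm s t = sync t (step-co² s)

hasS-or-co : (ρ : FRules) → ∃ (λ β → hasS ρ β ≡ true) →
             ∀ β → hasS ρ β ≡ true ⊎ hasS ρ (co β) ≡ true
hasS-or-co ρ (a  , e) a  = inj₁ e
hasS-or-co ρ (a  , e) a̅ = inj₂ e
hasS-or-co ρ (a̅ , e) a  = inj₂ e
hasS-or-co ρ (a̅ , e) a̅ = inj₁ e

data ∥≈f : CTerm → CTerm → Set where
  same   : ∀ {p} → ∥≈f p p
  ∥-swap : ∀ {p q} → ∥≈f (p ∥ q) (q ∥ p)
  ∥-f    : ∀ {p q} → ∥≈f (p ∥ q) (f p q +ₜ f q p)

module _ (ρ : FRules) where

  ∥-comm-step : ∀ {p q μ r} → Step ρ (p ∥ q) μ r →
                Σ CTerm λ r' → Step ρ (q ∥ p) μ r' × ∥≈f r r'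
  ∥-comm-step (parL s)   = _ , parR s , ∥-swap
  ∥-comm-step (parR s)   = _ , parL s , ∥-swap
  ∥-comm-step (sync s t) = _ , sync-comm s t , ∥-swap

  ∥-comm-step⁻ : ∀ {p q μ r} → Step ρ (q ∥ p) μ r →
                 Σ CTerm λ r' → Step ρ (p ∥ q) μ r' × ∥≈f r' r
  ∥-comm-step⁻ (parL s)   = _ , parR s , ∥-swap
  ∥-comm-step⁻ (parR s)   = _ , parL s , ∥-swap
  ∥-comm-step⁻ (sync s t) = _ , sync-comm s t , ∥-swap

  f-step⇒∥-step : ∀ {p q μ r} → Step ρ (f p q +ₜ f q p) μ r →
                  Σ CTerm λ r' → Step ρ (p ∥ q) μ r' × ∥≈f r' r
  f-step⇒∥-step (sumL (fS _ s t)) = _ , sync s t , same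
  f-step⇒∥-step (sumL (fL _ s))   = _ , parL s , same
  f-step⇒∥-step (sumL (fR _ t))   = _ , parR t , same
  f-step⇒∥-step (sumR (fS _ s t)) = _ , sync-comm s t , ∥-swap
  f-step⇒∥-step (sumR (fL _ s))   = _ , parR s , ∥-swap
  f-step⇒∥-step (sumR (fR _ t))   = _ , parL t , ∥-swap

  module _ (hasS-some : ∃ λ β → hasS ρ β ≡ true)
           (hasL-or-R : ∀ μ → hasL ρ μ ≡ true ⊎ hasR ρ μ ≡ true) where

    ∥-step⇒f-step : ∀ {p q μ r} → Step ρ (p ∥ q) μ r →
                    Σ CTerm λ r' → Step ρ (f p q +ₜ f q p) μ r' × ∥≈f r r'
    ∥-step⇒f-step {μ = μ} (parL s) with hasL-or-R μ
    ... | inj₁ e = _ , sumL (fL e s) , same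
    ... | inj₂ e = _ , sumR (fR e s) , ∥-swap
    ∥-step⇒f-step {μ = μ} (parR t) with hasL-or-R μ
    ... | inj₁ e = _ , sumR (fL e t) , ∥-swap
    ... | inj₂ e = _ , sumL (fR e t) , same
    ∥-step⇒f-step (sync {β = β} s t) with hasS-or-co ρ hasS-some β
    ... | inj₁ e = _ , sumL (fS e s t) , same
    ... | inj₂ e = _ , sumR (fS e t (step-co² s)) , ∥-swap

    ∥≈f-isBisimulation : IsBisimulation ρ ∥≈f
    ∥≈f-isBisimulation same   = (λ s → _ , s , same) , (λ s → _ , s , same)
    ∥≈f-isBisimulation ∥-swap = ∥-comm-step , ∥-comm-step⁻
    ∥≈f-isBisimulation ∥-f    = ∥-step⇒f-step , f-step⇒∥-step

proposition4 : (ρ : FRules) →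
    (∃ λ β → hasS ρ β ≡ true) →
    (∀ μ → hasL ρ μ ≡ true ⊎ hasR ρ μ ≡ true) →
    Sound ρ (x ∥ y) (f x y +ₜ f y x)
proposition4 ρ hasS-some hasL-or-R σ =
  ∥≈f , ∥≈f-isBisimulation ρ hasS-some hasL-or-R , ∥-f
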